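{- A composite positive integer $n$ is a Carmichael number if and only if $n$ is a weak Carmichael number and $\mathrm{rad}(\varphi(n))\mid n-1$.
   Context: $\mathrm{rad}(m)$ denotes the product of the distinct primes dividing $m$; $\varphi$ is Euler's totient function. A Carmichael number is a composite positive integer $n$ with $a^{n-1}\equiv 1\pmod n$ for all integers $a$ coprime to $n$. A composite positive integer $n$ is called a weak Carmichael number if $\sum_{1\le k\le n-1,\ \gcd(k,n)=1} k^{n-1}\equiv \varphi(n)\pmod{n}$. -}

module Defs where

open import Data.Nat using (ℕ; zero; suc; _+_; _*_; _∸_; _^_; NonZero)
open import Data.Nat.DivMod using (_%_)
open import Data.Nat.Divisibility using (_∣_; _∣?_)
open import Data.Nat.GCD using (gcd)
open import Data.Nat.Coprimality using (Coprime; coprime?)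
open import Data.Nat.Primality using (Prime; prime?; Composite)
open import Data.List using (List; filter; upTo; map; length)
open import Data.Nat.ListAction using (sum; product)
open import Data.Product using (_×_)
open import Relation.Binary.PropositionalEquality using (_≡_)
open import Relation.Nullary.Decidable using (_×-dec_)

range1 : ℕ → List ℕ
range1 n = map suc (upTo n)

φ : ℕ → ℕ
φ n = length (filter (λ k → coprime? k n) (range1 n))

rad : ℕ → ℕ
rad m = product (filter (λ p → prime? p ×-dec (p ∣? m)) (range1 m))

_≡_[mod_] : ℕ → ℕ → (n : ℕ) → .{{NonZero n}} → Set
a ≡ b [mod n ] = a % n ≡ b % n

Carmichael : (n : ℕ) → .{{NonZero n}} → Set
Carmichael n = Composite n × (∀ a → Coprime a n → (a ^ (n ∸ 1)) ≡ 1 [mod n ])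

powerSum : ℕ → ℕ
powerSum n = sum (map (λ k → k ^ (n ∸ 1)) (filter (λ k → coprime? k n) (range1 (n ∸ 1))))

WeakCarmichael : (n : ℕ) → .{{NonZero n}} → Set
WeakCarmichael n = Composite n × (powerSum n ≡ φ n [mod n ])

-- A Carmichael number n kills every unit with the exponent e = n − 1, so each term of the power sum
-- ∑_{k ⊥ n} k ^ e is 1 and the sum is φ(n). Comparing power sums of residues modulo a prime p ∣ n
-- with Fermat shows p − 1 ∣ e, and if p² ∣ n the unit 1 + n / p would force p ∣ e, so n is squarefree;
-- as then φ(n) = ∏_{p ∣ n} (p − 1), every prime factor of φ(n) divides e. Conversely, rad φ(n) ∣ n − 1
-- makes φ(n) a unit modulo n. Since k ↦ a k permutes the units, a ^ e ∑ k ^ e ≡ ∑ k ^ e ≡ φ(n),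
-- and cancelling φ(n) gives a ^ e ≡ 1.

module Submission where

open import Defs
import Algebra.Definitions.RawSemiring as RawSemiring
import Algebra.Properties.CommutativeMonoid.Sum as CommutativeMonoidSum
import Algebra.Properties.CommutativeSemiring.Binomial as Binomial
import Algebra.Properties.CommutativeSemiring.Exp as Exp
import Algebra.Properties.Semiring.Sum as SemiringSum
open import Data.Bool using (Bool; true; false; if_then_else_; _∧_)
open import Data.Bool.Properties using (∧-identityʳ)
open import Data.Empty using (⊥; ⊥-elim)
open import Data.Fin using (Fin; toℕ; fromℕ<)
open import Data.Fin.Permutation using (Permutation; permutation; _⟨$⟩ʳ_)
open import Data.Fin.Properties using (toℕ<n; toℕ-fromℕ<; toℕ-injective)
open import Data.List using (List; []; _∷_; filter; map; applyUpTo; upTo; length)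
open import Data.List.Properties using (map-∘; map-applyUpTo)
open import Data.List.Membership.Propositional using (_∈_)
open import Data.List.Membership.Propositional.Properties using (∈-filter⁺; ∈-map⁺; ∈-upTo⁺)
open import Data.List.Relation.Unary.All as All using (All; []; _∷_)
open import Data.List.Relation.Unary.All.Properties using (all-filter)
open import Data.List.Relation.Unary.AllPairs using (_∷_)
open import Data.List.Relation.Unary.Unique.Propositional using (Unique)
import Data.List.Relation.Unary.Unique.Propositional.Properties as Unique
open import Data.Nat
open import Data.Nat.Combinatorics using (_C_; nCn≡1; nCk≡nC[n∸k]; nC1≡n)
open import Data.Nat.Coprimality
  using (Coprime; coprime?; coprime-+; coprime-Bézout; coprime-divisor; prime⇒coprime; 1-coprimeTo; ¬0-coprimeTo-2+)
  renaming (sym to coprime-sym)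
open import Data.Nat.Divisibility
open import Data.Nat.DivMod
open import Data.Nat.GCD using (module Bézout)
open import Data.Nat.Induction using (<-rec)
open import Data.Nat.ListAction using (sum; product)
open import Data.Nat.ListAction.Properties using (∈⇒∣product)
open import Data.Nat.Primality
open import Data.Nat.Primality.Factorisation using (factorise; factorisationHasAllPrimeFactors)
open import Data.Nat.Properties
open import Algebra.Definitions.RawMonoid +-0-rawMonoid using () renaming (_×_ to _×ℕ_)
open import Data.Nat.Tactic.RingSolver using (solve-∀)
open import Data.Product using (∃; _×_; _,_; proj₁; proj₂)
open import Data.Sum using (_⊎_; inj₁; inj₂)
open import Function using (_∘_; id; _⇔_; mk⇔)
open import Relation.Nullary using (¬_; Dec; does; proof; ofʸ; ofⁿ)
open import Relation.Nullary.Decidable using (dec-true; dec-false; does-⇔; _×-dec_; ¬?)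
open import Relation.Binary.PropositionalEquality
open import Relation.Unary using (Pred; Decidable)

private
  variable
    a b c d k m n p : ℕ

-- Finite sums and products

module Sum = SemiringSum +-*-semiring
module Prod = CommutativeMonoidSum *-1-commutativeMonoid

-- ∑< N f = f 0 + f 1 + ⋯ + f (N ∸ 1), definitionally f 0 + ∑< N' (f ∘ suc) when N = suc N'
∑< : ℕ → (ℕ → ℕ) → ℕ
∑< N f = Sum.sum {N} (f ∘ toℕ)

∏< : ℕ → (ℕ → ℕ) → ℕ
∏< N f = Prod.sum {N} (f ∘ toℕ)

∑<-cong : ∀ N {f g} → (∀ k → k < N → f k ≡ g k) → ∑< N f ≡ ∑< N g
∑<-cong N f≡g = Sum.sum-cong-≗ (λ i → f≡g (toℕ i) (toℕ<n i))

∏<-cong : ∀ N {f g} → (∀ k → k < N → f k ≡ g k) → ∏< N f ≡ ∏< N g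
∏<-cong N f≡g = Prod.sum-cong-≗ (λ i → f≡g (toℕ i) (toℕ<n i))

∑<-snoc : ∀ N f → ∑< (suc N) f ≡ ∑< N f + f N
∑<-snoc zero f = +-comm (f 0) 0
∑<-snoc (suc N) f = trans (cong (f 0 +_) (∑<-snoc N (f ∘ suc))) (sym (+-assoc (f 0) _ _))

∑<-+ : ∀ M N f → ∑< (M + N) f ≡ ∑< M f + ∑< N (λ k → f (M + k))
∑<-+ zero N f = refl
∑<-+ (suc M) N f = trans (cong (f 0 +_) (∑<-+ M N (f ∘ suc))) (sym (+-assoc (f 0) _ _))

∑<-distrib-+ : ∀ N f g → ∑< N (λ k → f k + g k) ≡ ∑< N f + ∑< N g
∑<-distrib-+ N f g = Sum.∑-distrib-+ {N} (f ∘ toℕ) (g ∘ toℕ)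

*-distribˡ-∑< : ∀ N x f → x * ∑< N f ≡ ∑< N (λ k → x * f k)
*-distribˡ-∑< N x f = Sum.*-distribˡ-sum {N} x (f ∘ toℕ)

∑<-comm : ∀ M N (f : ℕ → ℕ → ℕ) → ∑< M (λ i → ∑< N (f i)) ≡ ∑< N (λ j → ∑< M (λ i → f i j))
∑<-comm M N f = Sum.∑-comm {M} {N} (λ i j → f (toℕ i) (toℕ j))

×≡* : ∀ m x → m ×ℕ x ≡ m * x
×≡* zero x = refl
×≡* (suc m) x = cong (x +_) (×≡* m x)

∑<-const : ∀ N x → ∑< N (λ _ → x) ≡ N * x
∑<-const N x = trans (Sum.sum-replicate N) (×≡* N x)

∑<-periodic : ∀ M f → (∀ k → f (M + k) ≡ f k) → ∀ j → ∑< (j * M) f ≡ j * ∑< M f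
∑<-periodic M f period zero = refl
∑<-periodic M f period (suc j) = begin
  ∑< (M + j * M) f                      ≡⟨ ∑<-+ M (j * M) f ⟩
  ∑< M f + ∑< (j * M) (λ k → f (M + k)) ≡⟨ cong (∑< M f +_) (∑<-cong (j * M) (λ k _ → period k)) ⟩
  ∑< M f + ∑< (j * M) f                 ≡⟨ cong (∑< M f +_) (∑<-periodic M f period j) ⟩
  ∑< M f + j * ∑< M f                   ∎
  where open ≡-Reasoning

∑<-zero : ∀ N f → (∀ k → k < N → f k ≡ 0) → ∑< N f ≡ 0
∑<-zero N f f≡0 = trans (∑<-cong N f≡0) (trans (∑<-const N 0) (*-zeroʳ N))

∑<-multiples : ∀ p .{{_ : NonZero p}} f → (∀ k → ¬ p ∣ k → f k ≡ 0) →
  ∀ j → ∑< (j * p) f ≡ ∑< j (λ i → f (i * p))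
∑<-multiples p@(suc p′) f f≡0 zero = refl
∑<-multiples p@(suc p′) f f≡0 (suc j) = begin
  ∑< (p + j * p) f                            ≡⟨ ∑<-+ p (j * p) f ⟩
  ∑< p f + ∑< (j * p) (λ k → f (p + k))       ≡⟨ cong₂ _+_ first-block (∑<-multiples p _ shifted j) ⟩
  f 0 + ∑< j (λ i → f (p + i * p))            ∎
  where
  open ≡-Reasoning
  first-block : ∑< p f ≡ f 0
  first-block = trans (cong (f 0 +_) (∑<-zero p′ (f ∘ suc) (λ k k<p′ → f≡0 (suc k)
    (λ p∣1+k → <-irrefl refl (≤-<-trans (∣⇒≤ p∣1+k) (s≤s k<p′))))))
    (+-identityʳ (f 0))
  shifted : ∀ k → ¬ p ∣ k → f (p + k) ≡ 0
  shifted k p∤k = f≡0 (p + k) (λ p∣p+k → p∤k (∣m+n∣m⇒∣n p∣p+k ∣-refl))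

∑<-∣ : ∀ N f → (∀ k → k < N → d ∣ f k) → d ∣ ∑< N f
∑<-∣ zero f _ = _ ∣0
∑<-∣ (suc N) f d∣f = ∣m∣n⇒∣m+n (d∣f 0 z<s) (∑<-∣ N (f ∘ suc) (λ k k<N → d∣f (suc k) (s≤s k<N)))

module _ {N : ℕ} (σ τ : ℕ → ℕ)
  (σ< : ∀ k → k < N → σ k < N) (τ< : ∀ k → k < N → τ k < N)
  (στ : ∀ k → k < N → σ (τ k) ≡ k) (τσ : ∀ k → k < N → τ (σ k) ≡ k) where

  private
    liftFin : (f : ℕ → ℕ) → (∀ k → k < N → f k < N) → Fin N → Fin N
    liftFin f f< i = fromℕ< (f< (toℕ i) (toℕ<n i))

    π : Permutation N N
    π = permutation (liftFin σ σ<) (liftFin τ τ<)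
      (λ i → toℕ-injective (trans (toℕ-fromℕ< _) (trans (cong σ (toℕ-fromℕ< _)) (στ (toℕ i) (toℕ<n i)))))
      (λ i → toℕ-injective (trans (toℕ-fromℕ< _) (trans (cong τ (toℕ-fromℕ< _)) (τσ (toℕ i) (toℕ<n i)))))

    π-toℕ : ∀ i → σ (toℕ i) ≡ toℕ (π ⟨$⟩ʳ i)
    π-toℕ i = sym (toℕ-fromℕ< _)

  ∑<-reindex : ∀ f → ∑< N (f ∘ σ) ≡ ∑< N f
  ∑<-reindex f = trans (Sum.sum-cong-≗ (cong f ∘ π-toℕ)) (sym (Sum.sum-permute (f ∘ toℕ) π))

  ∏<-reindex : ∀ f → ∏< N (f ∘ σ) ≡ ∏< N f
  ∏<-reindex f = trans (Prod.sum-cong-≗ (cong f ∘ π-toℕ)) (sym (Prod.sum-permute (f ∘ toℕ) π))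

-- Congruences

module _ {n : ℕ} .{{_ : NonZero n}} where

  +-cong-mod : a ≡ b [mod n ] → c ≡ d [mod n ] → (a + c) ≡ (b + d) [mod n ]
  +-cong-mod {a} {b} {c} {d} a≡b c≡d = begin
    (a + c) % n             ≡⟨ %-distribˡ-+ a c n ⟩
    (a % n + c % n) % n     ≡⟨ cong₂ (λ x y → (x + y) % n) a≡b c≡d ⟩
    (b % n + d % n) % n     ≡⟨ %-distribˡ-+ b d n ⟨
    (b + d) % n             ∎
    where open ≡-Reasoning

  *-cong-mod : a ≡ b [mod n ] → c ≡ d [mod n ] → (a * c) ≡ (b * d) [mod n ]
  *-cong-mod {a} {b} {c} {d} a≡b c≡d = begin
    (a * c) % n             ≡⟨ %-distribˡ-* a c n ⟩
    (a % n * (c % n)) % n   ≡⟨ cong₂ (λ x y → (x * y) % n) a≡b c≡d ⟩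
    (b % n * (d % n)) % n   ≡⟨ %-distribˡ-* b d n ⟨
    (b * d) % n             ∎
    where open ≡-Reasoning

  ^-cong-mod : ∀ k → a ≡ b [mod n ] → (a ^ k) ≡ (b ^ k) [mod n ]
  ^-cong-mod zero a≡b = refl
  ^-cong-mod (suc k) a≡b = *-cong-mod a≡b (^-cong-mod k a≡b)

  %-mod : ∀ a → (a % n) ≡ a [mod n ]
  %-mod a = m%n%n≡m%n a n

  -- x ≡ x + y (mod n) forces n ∣ y: compare the quotients of x and x + y by n
  ≡-+-mod⇒∣ : ∀ x y → x ≡ (x + y) [mod n ] → n ∣ y
  ≡-+-mod⇒∣ x y x≡x+y = ∣m+n∣m⇒∣n (subst (n ∣_) quotients (n∣m*n ((x + y) / n))) (n∣m*n (x / n))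
    where
    quotients : (x + y) / n * n ≡ x / n * n + y
    quotients = +-cancelˡ-≡ (x % n) _ _ (begin
      x % n + (x + y) / n * n       ≡⟨ cong (_+ (x + y) / n * n) x≡x+y ⟩
      (x + y) % n + (x + y) / n * n ≡⟨ m≡m%n+[m/n]*n (x + y) n ⟨
      x + y                         ≡⟨ cong (_+ y) (m≡m%n+[m/n]*n x n) ⟩
      x % n + x / n * n + y         ≡⟨ +-assoc (x % n) _ y ⟩
      x % n + (x / n * n + y)       ∎)
      where open ≡-Reasoning

  inverse-mod : Coprime c n → ∃ λ u → (c * u) ≡ 1 [mod n ]
  inverse-mod {c} c⊥n with coprime-Bézout (coprime-sym c⊥n)
  ... | Bézout.-+ x y 1+xn≡yc = y , (begin
    (c * y) % n     ≡⟨ cong (_% n) (trans (*-comm c y) (sym 1+xn≡yc)) ⟩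
    (1 + x * n) % n ≡⟨ %-remove-+ʳ 1 (n∣m*n x) ⟩
    1 % n           ∎)
    where open ≡-Reasoning
  -- here y * c ≡ -1, so y * (n ∸ 1) ≡ (-1) * (-1) is the inverse
  ... | Bézout.+- x y 1+yc≡xn = y * (n ∸ 1) , (begin
    (c * (y * (n ∸ 1))) % n                 ≡⟨ %-remove-+ʳ _ (n∣m*n x) ⟨
    (c * (y * (n ∸ 1)) + x * n) % n         ≡⟨ cong (λ z → (c * (y * (n ∸ 1)) + z) % n) 1+yc≡xn ⟨
    (c * (y * (n ∸ 1)) + (1 + y * c)) % n   ≡⟨ cong (_% n) (expand c y (n ∸ 1)) ⟩
    (1 + c * y * suc (n ∸ 1)) % n           ≡⟨ cong (λ z → (1 + c * y * z) % n) (suc-pred n) ⟩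
    (1 + c * y * n) % n                     ≡⟨ %-remove-+ʳ 1 (n∣m*n (c * y)) ⟩
    1 % n                                   ∎)
    where
    open ≡-Reasoning
    expand : ∀ c y m → c * (y * m) + (1 + y * c) ≡ 1 + c * y * suc m
    expand = solve-∀

  *-cancelˡ-mod : Coprime c n → (c * a) ≡ (c * b) [mod n ] → a ≡ b [mod n ]
  *-cancelˡ-mod {c} {a} {b} c⊥n ca≡cb with inverse-mod c⊥n
  ... | u , cu≡1 = begin
    a % n             ≡⟨ cong (_% n) (*-identityˡ a) ⟨
    (1 * a) % n       ≡⟨ *-cong-mod {a = 1} (trans (sym cu≡1) (cong (_% n) (*-comm c u))) refl ⟩
    (u * c * a) % n   ≡⟨ cong (_% n) (*-assoc u c a) ⟩
    (u * (c * a)) % n ≡⟨ *-cong-mod {a = u} refl ca≡cb ⟩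
    (u * (c * b)) % n ≡⟨ cong (_% n) (*-assoc u c b) ⟨
    (u * c * b) % n   ≡⟨ *-cong-mod {b = 1} (trans (cong (_% n) (*-comm u c)) cu≡1) refl ⟩
    (1 * b) % n       ≡⟨ cong (_% n) (*-identityˡ b) ⟩
    b % n             ∎
    where open ≡-Reasoning

≡-mod-∣ : ∀ {m n} .{{_ : NonZero m}} .{{_ : NonZero n}} → m ∣ n → a ≡ b [mod n ] → a ≡ b [mod m ]
≡-mod-∣ {a} {b} {m} {n} m∣n a≡b =
  trans (sym (m∣n⇒o%n%m≡o%m m n a m∣n)) (trans (cong (_% m) a≡b) (m∣n⇒o%n%m≡o%m m n b m∣n))

prime⇒1<p : Prime p → 1 < p
prime⇒1<p {p} (prime {{p>1}} _) = nonTrivial⇒n>1 p {{p>1}}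

coprime-∣ˡ : b ∣ a → Coprime a n → Coprime b n
coprime-∣ˡ b∣a a⊥n (d∣b , d∣n) = a⊥n (∣-trans d∣b b∣a , d∣n)

coprime-*ˡ : Coprime a n → Coprime b n → Coprime (a * b) n
coprime-*ˡ {a} {n} {b} a⊥n b⊥n {d} (d∣ab , d∣n) = b⊥n (coprime-divisor d⊥a d∣ab , d∣n)
  where
  d⊥a : Coprime d a
  d⊥a (e∣d , e∣a) = a⊥n (e∣a , ∣-trans e∣d d∣n)

coprime-*ʳ : Coprime n a → Coprime n b → Coprime n (a * b)
coprime-*ʳ n⊥a n⊥b = coprime-sym (coprime-*ˡ (coprime-sym n⊥a) (coprime-sym n⊥b))

coprime-∣ʳ : b ∣ a → Coprime n a → Coprime n b
coprime-∣ʳ b∣a n⊥a = coprime-sym (coprime-∣ˡ b∣a (coprime-sym n⊥a))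

coprime-% : .{{_ : NonZero n}} → Coprime a n → Coprime (a % n) n
coprime-% {n} {a} a⊥n (d∣a%n , d∣n) = a⊥n (∣n∣m%n⇒∣m d∣n d∣a%n , d∣n)

coprime-%⁻ : .{{_ : NonZero n}} → Coprime (a % n) n → Coprime a n
coprime-%⁻ {n} {a} a%n⊥n {d} (d∣a , d∣n) = a%n⊥n (d∣a%n , d∣n)
  where
  d∣a%n : d ∣ a % n
  d∣a%n = ∣m+n∣m⇒∣n (subst (d ∣_) (trans (m≡m%n+[m/n]*n a n) (+-comm (a % n) _)) d∣a)
                     (∣n⇒∣m*n (a / n) d∣n)

coprime-+⁻ : Coprime (n + a) n → Coprime a n
coprime-+⁻ n+a⊥n (d∣a , d∣n) = n+a⊥n (∣m∣n⇒∣m+n d∣n d∣a , d∣n)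

prime∤⇒coprime : Prime p → ¬ p ∣ a → Coprime p a
prime∤⇒coprime p-prime p∤a {d} (d∣p , d∣a) with prime⇒irreducible p-prime d∣p
... | inj₁ d≡1 = d≡1
... | inj₂ refl = ⊥-elim (p∤a d∣a)

prime∤1 : Prime p → ¬ p ∣ 1
prime∤1 p-prime p∣1 = <-irrefl (sym (∣1⇒≡1 p∣1)) (prime⇒1<p p-prime)

coprime⇒prime∤ : Prime p → Coprime p a → ¬ p ∣ a
coprime⇒prime∤ {p} p-prime p⊥a p∣a = prime∤1 p-prime (subst (p ∣_) (p⊥a (∣-refl , p∣a)) ∣-refl)

∣suc∧∣⇒∣1 : d ∣ suc a → d ∣ a → d ∣ 1
∣suc∧∣⇒∣1 {d} {a} d∣1+a d∣a = ∣m+n∣m⇒∣n (subst (d ∣_) (+-comm 1 a) d∣1+a) d∣a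

∣n∧∣n∸1⇒∣1 : .{{_ : NonZero n}} → d ∣ n → d ∣ n ∸ 1 → d ∣ 1
∣n∧∣n∸1⇒∣1 {n} d∣n = ∣suc∧∣⇒∣1 (subst (_ ∣_) (sym (suc-pred n)) d∣n)

-- a common divisor of 1 + s and n is coprime to s, hence divides k, hence s
suc-coprime : ∀ {k s} → k ∣ s → n ∣ s * k → Coprime (suc s) n
suc-coprime {n} {k} {s} k∣s n∣sk {d} (d∣1+s , d∣n) = ∣1⇒≡1 (∣suc∧∣⇒∣1 d∣1+s d∣s)
  where
  d⊥s : Coprime d s
  d⊥s (c∣d , c∣s) = ∣1⇒≡1 (∣suc∧∣⇒∣1 (∣-trans c∣d d∣1+s) c∣s)
  d∣s : d ∣ s
  d∣s = ∣-trans (coprime-divisor d⊥s (∣-trans d∣n n∣sk)) k∣s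

prime-factor : 1 < n → ∃ λ q → Prime q × q ∣ n
prime-factor {n} 1<n with factorise n {{>-nonZero (<-trans z<s 1<n)}}
... | record { factors = [] ; isFactorisation = n≡1 } = ⊥-elim (<-irrefl (sym n≡1) 1<n)
... | record { factors = q ∷ qs ; isFactorisation = refl ; factorsPrime = q-prime ∷ _ } = q , q-prime , m∣m*n _

primes-coprime⇒coprime : .{{_ : NonZero b}} → (∀ q → Prime q → q ∣ a → q ∣ b → ⊥) → Coprime a b
primes-coprime⇒coprime {b} no-common {d} (d∣a , d∣b) with d
... | 0 = ⊥-elim (≢-nonZero⁻¹ b (0∣⇒≡0 d∣b))
... | 1 = refl
... | suc (suc d′) with prime-factor {suc (suc d′)} (s≤s z<s)
...   | q , q-prime , q∣d = ⊥-elim (no-common q q-prime (∣-trans q∣d d∣a) (∣-trans q∣d d∣b))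

module _ {n : ℕ} .{{_ : NonZero n}} where

  ∑<-cong-mod : ∀ N {f g} → (∀ k → k < N → f k ≡ g k [mod n ]) → ∑< N f ≡ ∑< N g [mod n ]
  ∑<-cong-mod zero f≡g = refl
  ∑<-cong-mod (suc N) f≡g = +-cong-mod (f≡g 0 z<s) (∑<-cong-mod N (λ k k<N → f≡g (suc k) (s≤s k<N)))

  ∏<-cong-mod : ∀ N {f g} → (∀ k → k < N → f k ≡ g k [mod n ]) → ∏< N f ≡ ∏< N g [mod n ]
  ∏<-cong-mod zero f≡g = refl
  ∏<-cong-mod (suc N) f≡g = *-cong-mod (f≡g 0 z<s) (∏<-cong-mod N (λ k k<N → f≡g (suc k) (s≤s k<N)))

-- Sums and products over the units 0 ≤ k < n, gcd k n ≡ 1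

∑units : ℕ → (ℕ → ℕ) → ℕ
∑units n g = ∑< n (λ k → if does (coprime? k n) then g k else 0)

∏units : ℕ → (ℕ → ℕ) → ℕ
∏units n g = ∏< n (λ k → if does (coprime? k n) then g k else 1)

totient : ℕ → ℕ
totient n = ∑units n (λ _ → 1)

*-distribˡ-∑units : ∀ n x g → x * ∑units n g ≡ ∑units n (λ k → x * g k)
*-distribˡ-∑units n x g =
  trans (*-distribˡ-∑< n x (λ k → if does (coprime? k n) then g k else 0)) (∑<-cong n (λ k _ → term k))
  where
  term : ∀ k → x * (if does (coprime? k n) then g k else 0) ≡ (if does (coprime? k n) then x * g k else 0)
  term k with does (coprime? k n)
  ... | true = refl
  ... | false = *-zeroʳ x

∏<-if-* : ∀ N (b : ℕ → Bool) x (g : ℕ → ℕ) →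
  ∏< N (λ k → if b k then x * g k else 1) ≡
    x ^ ∑< N (λ k → if b k then 1 else 0) * ∏< N (λ k → if b k then g k else 1)
∏<-if-* zero b x g = refl
∏<-if-* (suc N) b x g = trans (cong ((if b 0 then x * g 0 else 1) *_) (∏<-if-* N (b ∘ suc) x (g ∘ suc))) (head (b 0))
  where
  count = ∑< N (λ k → if b (suc k) then 1 else 0)
  rest = ∏< N (λ k → if b (suc k) then g (suc k) else 1)
  regroup : ∀ x y z w → x * y * (z * w) ≡ x * z * (y * w)
  regroup = solve-∀
  head : ∀ β → (if β then x * g 0 else 1) * (x ^ count * rest) ≡
    x ^ ((if β then 1 else 0) + count) * ((if β then g 0 else 1) * rest)
  head true  = regroup x (g 0) (x ^ count) rest
  head false = trans (*-identityˡ _) (cong (x ^ count *_) (sym (*-identityˡ rest)))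

∏units-* : ∀ n x g → ∏units n (λ k → x * g k) ≡ x ^ totient n * ∏units n g
∏units-* n = ∏<-if-* n (λ k → does (coprime? k n))

module _ {n : ℕ} .{{_ : NonZero n}} {g h : ℕ → ℕ} (g≡h : ∀ k → Coprime k n → g k ≡ h k [mod n ]) where

  ∑units-cong-mod : ∑units n g ≡ ∑units n h [mod n ]
  ∑units-cong-mod = ∑<-cong-mod n (λ k _ → term k)
    where
    term : ∀ k → (if does (coprime? k n) then g k else 0) ≡ (if does (coprime? k n) then h k else 0) [mod n ]
    term k with does (coprime? k n) | proof (coprime? k n)
    ... | true  | ofʸ k⊥n = g≡h k k⊥n
    ... | false | ofⁿ _   = refl

  ∏units-cong-mod : ∏units n g ≡ ∏units n h [mod n ]
  ∏units-cong-mod = ∏<-cong-mod n (λ k _ → term k)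
    where
    term : ∀ k → (if does (coprime? k n) then g k else 1) ≡ (if does (coprime? k n) then h k else 1) [mod n ]
    term k with does (coprime? k n) | proof (coprime? k n)
    ... | true  | ofʸ k⊥n = g≡h k k⊥n
    ... | false | ofⁿ _   = refl

module _ {n : ℕ} .{{_ : NonZero n}} {c : ℕ} (c⊥n : Coprime c n) where

  private
    u : ℕ
    u = proj₁ (inverse-mod c⊥n)

    cu≡1 : (c * u) ≡ 1 [mod n ]
    cu≡1 = proj₂ (inverse-mod c⊥n)

    uc≡1 : (u * c) ≡ 1 [mod n ]
    uc≡1 = trans (cong (_% n) (*-comm u c)) cu≡1

    σ τ : ℕ → ℕ
    σ k = (c * k) % n
    τ k = (u * k) % n

    cancel : ∀ x y k → k < n → (x * y) ≡ 1 [mod n ] → (x * ((y * k) % n)) % n ≡ k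
    cancel x y k k<n xy≡1 = begin
      (x * ((y * k) % n)) % n ≡⟨ *-cong-mod {a = x} refl (%-mod (y * k)) ⟩
      (x * (y * k)) % n       ≡⟨ cong (_% n) (*-assoc x y k) ⟨
      (x * y * k) % n         ≡⟨ *-cong-mod {b = 1} xy≡1 refl ⟩
      (1 * k) % n             ≡⟨ cong (_% n) (*-identityˡ k) ⟩
      k % n                   ≡⟨ m<n⇒m%n≡m k<n ⟩
      k                       ∎
      where open ≡-Reasoning

    σ-unit : ∀ k → does (coprime? (σ k) n) ≡ does (coprime? k n)
    σ-unit k = does-⇔ (mk⇔ from to) (coprime? (σ k) n) (coprime? k n)
      where
      from : Coprime (σ k) n → Coprime k n
      from σk⊥n = coprime-∣ˡ (n∣m*n c) (coprime-%⁻ {n} {c * k} σk⊥n)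
      to : Coprime k n → Coprime (σ k) n
      to k⊥n = coprime-% (coprime-*ˡ c⊥n k⊥n)

    σ< : ∀ k → k < n → σ k < n
    σ< k _ = m%n<n (c * k) n

    τ< : ∀ k → k < n → τ k < n
    τ< k _ = m%n<n (u * k) n

    στ : ∀ k → k < n → σ (τ k) ≡ k
    στ k k<n = cancel c u k k<n cu≡1

    τσ : ∀ k → k < n → τ (σ k) ≡ k
    τσ k k<n = cancel u c k k<n uc≡1

  ∑units-*-permute : ∀ g → ∑units n (λ k → g ((c * k) % n)) ≡ ∑units n g
  ∑units-*-permute g = trans (∑<-cong n (λ k _ → cong (λ b → if b then g (σ k) else 0) (sym (σ-unit k))))
                             (∑<-reindex σ τ σ< τ< στ τσ (λ k → if does (coprime? k n) then g k else 0))

  ∏units-*-permute : ∀ g → ∏units n (λ k → g ((c * k) % n)) ≡ ∏units n g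
  ∏units-*-permute g = trans (∏<-cong n (λ k _ → cong (λ b → if b then g (σ k) else 1) (sym (σ-unit k))))
                             (∏<-reindex σ τ σ< τ< στ τσ (λ k → if does (coprime? k n) then g k else 1))

∏<-coprime : ∀ N {f} → (∀ k → k < N → Coprime (f k) n) → Coprime (∏< N f) n
∏<-coprime {n} zero _ = 1-coprimeTo n
∏<-coprime (suc N) f⊥n = coprime-*ˡ (f⊥n 0 z<s) (∏<-coprime N (λ k k<N → f⊥n (suc k) (s≤s k<N)))

∏units-coprime : ∀ n → Coprime (∏units n id) n
∏units-coprime n = ∏<-coprime n (λ k _ → term k)
  where
  term : ∀ k → Coprime (if does (coprime? k n) then k else 1) n
  term k with does (coprime? k n) | proof (coprime? k n)
  ... | true  | ofʸ k⊥n = k⊥n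
  ... | false | ofⁿ _   = 1-coprimeTo n

-- multiplication by c permutes the units, so c ^ φ(n) * P ≡ P for their product P
euler : ∀ {n} .{{_ : NonZero n}} {c} → Coprime c n → (c ^ totient n) ≡ 1 [mod n ]
euler {n} {c} c⊥n = *-cancelˡ-mod (∏units-coprime n) (begin
  (P * c ^ totient n) % n          ≡⟨ cong (_% n) (*-comm P _) ⟩
  (c ^ totient n * P) % n          ≡⟨ cong (_% n) (∏units-* n c id) ⟨
  ∏units n (c *_) % n              ≡⟨ ∏units-cong-mod (λ k _ → sym (%-mod (c * k))) ⟩
  ∏units n (λ k → (c * k) % n) % n ≡⟨ cong (_% n) (∏units-*-permute c⊥n id) ⟩
  P % n                            ≡⟨ cong (_% n) (*-identityʳ P) ⟨
  (P * 1) % n                      ∎)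
  where
  open ≡-Reasoning
  P = ∏units n id

totient-prime : Prime p → totient p ≡ p ∸ 1
totient-prime {p@(suc p′)} p-prime = begin
  (if does (coprime? 0 p) then 1 else 0) + ∑< p′ unit ≡⟨ cong (λ b → (if b then 1 else 0) + ∑< p′ unit) 0-nonunit ⟩
  ∑< p′ unit                                         ≡⟨ ∑<-cong p′ (λ k k<p′ → 1+k-unit k k<p′) ⟩
  ∑< p′ (λ _ → 1)                                    ≡⟨ ∑<-const p′ 1 ⟩
  p′ * 1                                             ≡⟨ *-identityʳ p′ ⟩
  p′                                                 ∎
  where
  open ≡-Reasoning
  unit : ℕ → ℕ
  unit k = if does (coprime? (suc k) p) then 1 else 0
  0-nonunit : does (coprime? 0 p) ≡ false
  0-nonunit = dec-false (coprime? 0 p) (¬0-coprimeTo-2+ {{prime⇒nonTrivial p-prime}})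
  1+k-unit : ∀ k → k < p′ → unit k ≡ 1
  1+k-unit k k<p′ = cong (λ b → if b then 1 else 0)
    (dec-true (coprime? (suc k) p) (coprime-sym (prime⇒coprime p-prime (s≤s k<p′))))

fermat : ∀ {p} .{{_ : NonZero p}} → Prime p → 0 < b → b < p → (b ^ (p ∸ 1)) ≡ 1 [mod p ]
fermat {b} {p} p-prime 0<b b<p = subst (λ e → (b ^ e) ≡ 1 [mod p ]) (totient-prime p-prime) (euler b⊥p)
  where
  b⊥p : Coprime b p
  b⊥p = coprime-sym (prime⇒coprime p-prime {{>-nonZero 0<b}} b<p)

-- Power sums modulo a prime

module Binomialℕ = Binomial +-*-commutativeSemiring

^≡^ : ∀ x m → RawSemiring._^_ +-*-rawSemiring x m ≡ x ^ m
^≡^ x zero = refl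
^≡^ x (suc m) = cong (x *_) (^≡^ x m)

^-distrib-* : ∀ x y m → (x * y) ^ m ≡ x ^ m * y ^ m
^-distrib-* x y m = trans (sym (^≡^ (x * y) m))
  (trans (Exp.^-distrib-* +-*-commutativeSemiring x y m) (cong₂ _*_ (^≡^ x m) (^≡^ y m)))

binomial-theorem : ∀ b R → suc b ^ R ≡ ∑< (suc R) (λ j → (R C j) * b ^ j)
binomial-theorem b R = begin
  suc b ^ R                                   ≡⟨ cong (_^ R) (+-comm 1 b) ⟩
  (b + 1) ^ R                                 ≡⟨ ^≡^ (b + 1) R ⟨
  RawSemiring._^_ +-*-rawSemiring (b + 1) R   ≡⟨ Binomialℕ.theorem R b 1 ⟩
  Binomialℕ.binomialExpansion b 1 R           ≡⟨ Sum.sum-cong-≗ term ⟩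
  ∑< (suc R) (λ j → (R C j) * b ^ j)          ∎
  where
  open ≡-Reasoning
  term : ∀ j → Binomialℕ.binomialTerm b 1 R j ≡ (R C toℕ j) * b ^ toℕ j
  term j = trans (×≡* (R C toℕ j) _) (cong ((R C toℕ j) *_) (trans
    (cong₂ _*_ (^≡^ b (toℕ j)) (trans (^≡^ 1 (R ∸ toℕ j)) (^-zeroˡ (R ∸ toℕ j))))
    (*-identityʳ (b ^ toℕ j))))

∑powers : ℕ → ℕ → ℕ
∑powers N j = ∑< N (λ b → b ^ j)

-- telescoping ∑_{b<N} ((b+1)^R − b^R) = N^R, with the binomial theorem for (b+1)^R
∑powers-recurrence : ∀ N r → ∑< (suc r) (λ j → (suc r C j) * ∑powers N j) ≡ N ^ suc r
∑powers-recurrence N r = +-cancelʳ-≡ (∑powers N R) _ _ (begin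
  ∑< R T + ∑powers N R                                  ≡⟨ cong (∑< R T +_) T[R]≡∑powers ⟨
  ∑< R T + T R                                          ≡⟨ ∑<-snoc R T ⟨
  ∑< (suc R) T                                          ≡⟨ ∑<-cong (suc R) (λ j _ → *-distribˡ-∑< N (R C j) (_^ j)) ⟩
  ∑< (suc R) (λ j → ∑< N (λ b → (R C j) * b ^ j))      ≡⟨ ∑<-comm (suc R) N (λ j b → (R C j) * b ^ j) ⟩
  ∑< N (λ b → ∑< (suc R) (λ j → (R C j) * b ^ j))      ≡⟨ ∑<-cong N (λ b _ → binomial-theorem b R) ⟨
  ∑powers (suc N) R                                     ≡⟨ ∑<-snoc N (_^ R) ⟩
  ∑powers N R + N ^ R                                   ≡⟨ +-comm (∑powers N R) (N ^ R) ⟩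
  N ^ R + ∑powers N R                                   ∎)
  where
  open ≡-Reasoning
  R = suc r
  T : ℕ → ℕ
  T j = (R C j) * ∑powers N j
  T[R]≡∑powers : T R ≡ ∑powers N R
  T[R]≡∑powers = trans (cong (_* ∑powers N R) (nCn≡1 R)) (*-identityˡ (∑powers N R))

prime∣∑powers : Prime p → ∀ r → 0 < r → suc r < p → p ∣ ∑powers p r
prime∣∑powers {p} p-prime = <-rec (λ r → 0 < r → suc r < p → p ∣ ∑powers p r) step
  where
  step : ∀ r → (∀ {j} → j < r → 0 < j → suc j < p → p ∣ ∑powers p j) →
    0 < r → suc r < p → p ∣ ∑powers p r
  step r ih 0<r 1+r<p =
    coprime-divisor (prime⇒coprime p-prime 1+r<p) (subst (λ c → p ∣ c * ∑powers p r) (1+rCr r) p∣last)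
    where
    T : ℕ → ℕ
    T j = (suc r C j) * ∑powers p j
    p∣T : ∀ j → j < r → p ∣ T j
    p∣T zero    _   = ∣n⇒∣m*n (suc r C 0) (subst (p ∣_) (sym (trans (∑<-const p 1) (*-identityʳ p))) ∣-refl)
    p∣T (suc j) j<r = ∣n⇒∣m*n (suc r C suc j) (ih j<r z<s (<-trans (s≤s j<r) 1+r<p))
    p∣all : p ∣ ∑< r T + T r
    p∣all = subst (p ∣_) (trans (sym (∑powers-recurrence p r)) (∑<-snoc r T)) (m∣m*n (p ^ r))
    p∣last : p ∣ T r
    p∣last = ∣m+n∣m⇒∣n p∣all (∑<-∣ r T p∣T)
    1+rCr : ∀ r → suc r C r ≡ suc r
    1+rCr r = trans (nCk≡nC[n∸k] (n≤1+n r)) (trans (cong (suc r C_) (m+n∸n≡m 1 r)) (nC1≡n (suc r)))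

^≡1-% : ∀ {n} .{{_ : NonZero n}} {x e m} .{{_ : NonZero m}} →
  (x ^ m) ≡ 1 [mod n ] → (x ^ e) ≡ 1 [mod n ] → (x ^ (e % m)) ≡ 1 [mod n ]
^≡1-% {n} {x} {e} {m} x^m≡1 x^e≡1 = begin
  x ^ r % n                         ≡⟨ cong (_% n) (*-identityʳ (x ^ r)) ⟨
  (x ^ r * 1) % n                   ≡⟨ cong (λ z → (x ^ r * z) % n) (^-zeroˡ q) ⟨
  (x ^ r * 1 ^ q) % n               ≡⟨ *-cong-mod {a = x ^ r} {x ^ r} {(x ^ m) ^ q} {1 ^ q} refl (^-cong-mod q x^m≡1) ⟨
  (x ^ r * (x ^ m) ^ q) % n         ≡⟨ cong (λ z → (x ^ r * z) % n) (^-*-assoc x m q) ⟩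
  (x ^ r * x ^ (m * q)) % n         ≡⟨ cong (_% n) (^-distribˡ-+-* x r (m * q)) ⟨
  x ^ (r + m * q) % n               ≡⟨ cong (λ z → x ^ z % n) e≡r+mq ⟨
  x ^ e % n                         ≡⟨ x^e≡1 ⟩
  1 % n                             ∎
  where
  open ≡-Reasoning
  r = e % m
  q = e / m
  e≡r+mq : e ≡ r + m * q
  e≡r+mq = trans (m≡m%n+[m/n]*n e m) (cong (r +_) (*-comm q m))

∑powers≡p∸1 : ∀ {p r} .{{_ : NonZero p}} → 0 < r →
  (∀ b → 0 < b → b < p → (b ^ r) ≡ 1 [mod p ]) → ∑powers p r ≡ (p ∸ 1) [mod p ]
∑powers≡p∸1 {p@(suc p′)} {r@(suc _)} _ b^r≡1 = begin
  ∑< p′ (λ b → suc b ^ r) % p ≡⟨ ∑<-cong-mod p′ {λ b → suc b ^ r} (λ b b<p′ → b^r≡1 (suc b) z<s (s≤s b<p′)) ⟩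
  ∑< p′ (λ _ → 1) % p         ≡⟨ cong (_% p) (trans (∑<-const p′ 1) (*-identityʳ p′)) ⟩
  p′ % p                      ∎
  where open ≡-Reasoning

-- by Fermat, b ^ r ≡ 1 for the remainder r of e modulo p − 1, so ∑_{b<p} b ^ r ≡ p − 1 (mod p);
-- as p divides that power sum when 0 < r < p − 1, r must be 0
p∸1∣exponent : ∀ {p e} .{{_ : NonZero p}} → Prime p →
  (∀ b → 0 < b → b < p → (b ^ e) ≡ 1 [mod p ]) → (p ∸ 1) ∣ e
p∸1∣exponent {p@(suc p′)} {e} p-prime b^e≡1 = m%n≡0⇒n∣m e p′ (n≤0⇒n≡0 (≮⇒≥ r≯0))
  where
  0<p′ : 0 < p′
  0<p′ = ≤-pred (prime⇒1<p p-prime)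
  instance
    p′≢0 : NonZero p′
    p′≢0 = >-nonZero 0<p′
  r : ℕ
  r = e % p′
  b^r≡1 : ∀ b → 0 < b → b < p → (b ^ r) ≡ 1 [mod p ]
  b^r≡1 b 0<b b<p = ^≡1-% {x = b} {e} (fermat p-prime 0<b b<p) (b^e≡1 b 0<b b<p)
  r≯0 : ¬ 0 < r
  r≯0 0<r = <-irrefl (sym p′≡0) 0<p′
    where
    open ≡-Reasoning
    p′≡0 : p′ ≡ 0
    p′≡0 = begin
      p′              ≡⟨ m<n⇒m%n≡m (n<1+n p′) ⟨
      p′ % p          ≡⟨ ∑powers≡p∸1 0<r b^r≡1 ⟨
      ∑powers p r % p ≡⟨ n∣m⇒m%n≡0 _ p (prime∣∑powers p-prime r 0<r (s≤s (m%n<n e p′))) ⟩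
      0               ∎

coprime-*-∣ : Coprime a b → a ∣ c → b ∣ c → a * b ∣ c
coprime-*-∣ {a} {b} a⊥b a∣c (divides q refl) with coprime-divisor a⊥b (subst (a ∣_) (*-comm q b) a∣c)
... | divides s refl = divides s (*-assoc s a b)

product-distinct-primes-∣ : ∀ {ps} → All Prime ps → Unique ps → All (_∣ c) ps → product ps ∣ c
product-distinct-primes-∣ {c} [] _ _ = 1∣ c
product-distinct-primes-∣ {ps = p ∷ ps} (p-prime ∷ ps-prime) unique@(_ ∷ ps-unique) (p∣c ∷ ps∣c) =
  coprime-*-∣ (prime∤⇒coprime p-prime p∤∏ps) p∣c (product-distinct-primes-∣ ps-prime ps-unique ps∣c)
  where
  p∤∏ps : ¬ p ∣ product ps
  p∤∏ps p∣∏ps = Unique.Unique[x∷xs]⇒x∉xs unique (factorisationHasAllPrimeFactors p-prime p∣∏ps ps-prime)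

private
  prime-divisor? : ∀ m p → Dec (Prime p × p ∣ m)
  prime-divisor? m p = prime? p ×-dec (p ∣? m)

rad∣ : ∀ m → (∀ q → Prime q → q ∣ m → q ∣ c) → rad m ∣ c
rad∣ m q∣m⇒q∣c = product-distinct-primes-∣
  (All.map proj₁ divisors) distinct (All.map (λ (q-prime , q∣m) → q∣m⇒q∣c _ q-prime q∣m) divisors)
  where
  divisors : All (λ q → Prime q × q ∣ m) (filter (prime-divisor? m) (range1 m))
  divisors = all-filter (prime-divisor? m) (range1 m)
  distinct : Unique (filter (prime-divisor? m) (range1 m))
  distinct = Unique.filter⁺ (prime-divisor? m) (Unique.map⁺ suc-injective (Unique.upTo⁺ m))

prime∣rad : ∀ {q m} .{{_ : NonZero m}} → Prime q → q ∣ m → q ∣ rad m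
prime∣rad {q@(suc q′)} {m} q-prime q∣m = ∈⇒∣product (∈-filter⁺ (prime-divisor? m) q∈range (q-prime , q∣m))
  where
  q∈range : q ∈ range1 m
  q∈range = ∈-map⁺ suc (∈-upTo⁺ (∣⇒≤ q∣m))

-- The totient

sum-applyUpTo : ∀ N f → sum (applyUpTo f N) ≡ ∑< N f
sum-applyUpTo zero f = refl
sum-applyUpTo (suc N) f = cong (f 0 +_) (sum-applyUpTo N (f ∘ suc))

sum-map-range1 : ∀ N f → sum (map f (range1 N)) ≡ ∑< N (f ∘ suc)
sum-map-range1 N f = begin
  sum (map f (map suc (upTo N)))  ≡⟨ cong sum (map-∘ (upTo N)) ⟨
  sum (map (f ∘ suc) (upTo N))    ≡⟨ cong sum (map-applyUpTo id (f ∘ suc) N) ⟩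
  sum (applyUpTo (f ∘ suc) N)     ≡⟨ sum-applyUpTo N (f ∘ suc) ⟩
  ∑< N (f ∘ suc)                  ∎
  where open ≡-Reasoning

sum-map-filter : ∀ {ℓ} {P : Pred ℕ ℓ} (P? : Decidable P) g xs →
  sum (map g (filter P? xs)) ≡ sum (map (λ x → if does (P? x) then g x else 0) xs)
sum-map-filter P? g [] = refl
sum-map-filter P? g (x ∷ xs) with does (P? x)
... | true  = cong (g x +_) (sum-map-filter P? g xs)
... | false = sum-map-filter P? g xs

length≡sum-map-1 : ∀ (xs : List ℕ) → length xs ≡ sum (map (λ _ → 1) xs)
length≡sum-map-1 [] = refl
length≡sum-map-1 (x ∷ xs) = cong suc (length≡sum-map-1 xs)

∑<-rotate : ∀ N f → f 0 ≡ f N → ∑< N (f ∘ suc) ≡ ∑< N f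
∑<-rotate N f f0≡fN = +-cancelˡ-≡ (f 0) _ _ (begin
  ∑< (suc N) f     ≡⟨ ∑<-snoc N f ⟩
  ∑< N f + f N     ≡⟨ cong (∑< N f +_) f0≡fN ⟨
  ∑< N f + f 0     ≡⟨ +-comm (∑< N f) (f 0) ⟩
  f 0 + ∑< N f     ∎)
  where open ≡-Reasoning

-- φ counts 1 ≤ k ≤ n, totient counts 0 ≤ k < n: the sums differ only in k = 0 ↔ k = n, and gcd 0 n = gcd n n
φ≡totient : ∀ n → φ n ≡ totient n
φ≡totient n = begin
  length (filter unit? (range1 n))               ≡⟨ length≡sum-map-1 (filter unit? (range1 n)) ⟩
  sum (map (λ _ → 1) (filter unit? (range1 n)))  ≡⟨ sum-map-filter unit? (λ _ → 1) (range1 n) ⟩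
  sum (map unit (range1 n))                      ≡⟨ sum-map-range1 n unit ⟩
  ∑< n (unit ∘ suc)                              ≡⟨ ∑<-rotate n unit unit0≡unitn ⟩
  totient n                                      ∎
  where
  open ≡-Reasoning
  unit? : ∀ k → Dec (Coprime k n)
  unit? k = coprime? k n
  unit : ℕ → ℕ
  unit k = if does (unit? k) then 1 else 0
  0⊥n⇒n⊥n : Coprime 0 n → Coprime n n
  0⊥n⇒n⊥n 0⊥n (d∣n , _) = 0⊥n (_ ∣0 , d∣n)
  n⊥n⇒0⊥n : Coprime n n → Coprime 0 n
  n⊥n⇒0⊥n n⊥n (_ , d∣n) = n⊥n (d∣n , d∣n)
  unit0≡unitn : unit 0 ≡ unit n
  unit0≡unitn = cong (λ b → if b then 1 else 0) (does-⇔ (mk⇔ 0⊥n⇒n⊥n n⊥n⇒0⊥n) (unit? 0) (unit? n))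

powerSum≡∑units : ∀ n .{{_ : NonTrivial n}} → powerSum n ≡ ∑units n (_^ (n ∸ 1))
powerSum≡∑units n@(suc (suc m)) = begin
  powerSum n                                 ≡⟨ sum-map-filter (λ k → coprime? k n) (_^ suc m) (range1 (suc m)) ⟩
  sum (map term (range1 (suc m)))            ≡⟨ sum-map-range1 (suc m) term ⟩
  ∑< (suc m) (term ∘ suc)                    ≡⟨ cong (_+ ∑< (suc m) (term ∘ suc)) (term0≡0 (does (coprime? 0 n))) ⟨
  ∑units n (_^ suc m)                        ∎
  where
  open ≡-Reasoning
  term : ℕ → ℕ
  term k = if does (coprime? k n) then k ^ suc m else 0
  term0≡0 : ∀ b → (if b then 0 else 0) ≡ 0
  term0≡0 true = refl
  term0≡0 false = refl

coprime-prime*⇔ : Prime p → Coprime k (p * m) ⇔ (Coprime k m × ¬ p ∣ k)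
coprime-prime*⇔ {p} {k} {m} p-prime = mk⇔ to from
  where
  to : Coprime k (p * m) → Coprime k m × ¬ p ∣ k
  to k⊥pm = coprime-∣ʳ (n∣m*n p) k⊥pm , coprime⇒prime∤ p-prime (coprime-sym (coprime-∣ʳ (m∣m*n m) k⊥pm))
  from : Coprime k m × ¬ p ∣ k → Coprime k (p * m)
  from (k⊥m , p∤k) = coprime-*ʳ (coprime-sym (prime∤⇒coprime p-prime p∤k)) k⊥m

∑units-multiples : Prime p → ¬ p ∣ m →
  ∑< (p * m) (λ k → if does (coprime? k m) ∧ does (p ∣? k) then 1 else 0) ≡ totient m
∑units-multiples {p} {m} p-prime p∤m = begin
  ∑< (p * m) unit∧p∣             ≡⟨ cong (λ N → ∑< N unit∧p∣) (*-comm p m) ⟩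
  ∑< (m * p) unit∧p∣             ≡⟨ ∑<-multiples p unit∧p∣ off-multiples m ⟩
  ∑< m (λ i → unit∧p∣ (i * p))   ≡⟨ ∑<-cong m (λ i _ → on-multiples i) ⟩
  totient m                      ∎
  where
  open ≡-Reasoning
  instance
    p≢0 : NonZero p
    p≢0 = prime⇒nonZero p-prime
  unit∧p∣ : ℕ → ℕ
  unit∧p∣ k = if does (coprime? k m) ∧ does (p ∣? k) then 1 else 0
  off-multiples : ∀ k → ¬ p ∣ k → unit∧p∣ k ≡ 0
  off-multiples k p∤k rewrite dec-false (p ∣? k) p∤k with does (coprime? k m)
  ... | true  = refl
  ... | false = refl
  ip⊥m⇔i⊥m : ∀ i → Coprime (i * p) m ⇔ Coprime i m
  ip⊥m⇔i⊥m i = mk⇔ (coprime-∣ˡ (m∣m*n p)) (λ i⊥m → coprime-*ˡ i⊥m (prime∤⇒coprime p-prime p∤m))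
  on-multiples : ∀ i → unit∧p∣ (i * p) ≡ (if does (coprime? i m) then 1 else 0)
  on-multiples i rewrite dec-true (p ∣? (i * p)) (n∣m*n i) | ∧-identityʳ (does (coprime? (i * p) m)) =
    cong (λ b → if b then 1 else 0) (does-⇔ (ip⊥m⇔i⊥m i) (coprime? (i * p) m) (coprime? i m))

-- among k < p m, the units modulo m number p φ(m) and the units modulo p m are those not divisible by p
totient-prime* : Prime p → ¬ p ∣ m → totient (p * m) ≡ (p ∸ 1) * totient m
totient-prime* {p@(suc p′)} {m} p-prime p∤m = +-cancelʳ-≡ (totient m) _ _ (begin
  totient (p * m) + totient m                         ≡⟨ cong (totient (p * m) +_) (∑units-multiples p-prime p∤m) ⟨
  ∑< (p * m) unit-pm + ∑< (p * m) unit-m∧p∣           ≡⟨ ∑<-distrib-+ (p * m) unit-pm unit-m∧p∣ ⟨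
  ∑< (p * m) (λ k → unit-pm k + unit-m∧p∣ k)          ≡⟨ ∑<-cong (p * m) (λ k _ → partition k) ⟩
  ∑< (p * m) unit-m                                   ≡⟨ ∑<-periodic m unit-m unit-m-periodic p ⟩
  p * totient m                                       ≡⟨ +-comm (totient m) (p′ * totient m) ⟩
  p′ * totient m + totient m                          ∎)
  where
  open ≡-Reasoning
  indicator : Bool → ℕ
  indicator b = if b then 1 else 0
  unit-m unit-m∧p∣ unit-pm : ℕ → ℕ
  unit-m k    = indicator (does (coprime? k m))
  unit-m∧p∣ k = indicator (does (coprime? k m) ∧ does (p ∣? k))
  unit-pm k   = indicator (does (coprime? k (p * m)))
  partition : ∀ k → unit-pm k + unit-m∧p∣ k ≡ unit-m k
  partition k rewrite does-⇔ (coprime-prime*⇔ p-prime) (coprime? k (p * m)) (coprime? k m ×-dec ¬? (p ∣? k))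
    with does (coprime? k m) | does (p ∣? k)
  ... | true  | true  = refl
  ... | true  | false = refl
  ... | false | _     = refl
  unit-m-periodic : ∀ k → unit-m (m + k) ≡ unit-m k
  unit-m-periodic k = cong indicator (does-⇔ (mk⇔ coprime-+⁻ coprime-+) (coprime? (m + k) m) (coprime? k m))

Squarefree : ℕ → Set
Squarefree n = ∀ p → Prime p → ¬ p * p ∣ n

prime∣totient-squarefree : ∀ {q} n .{{_ : NonZero n}} → Squarefree n → Prime q → q ∣ totient n →
  ∃ λ p → Prime p × p ∣ n × q ∣ p ∸ 1
prime∣totient-squarefree {q} = <-rec P step
  where
  P : ℕ → Set
  P n = .{{_ : NonZero n}} → Squarefree n → Prime q → q ∣ totient n → ∃ λ p → Prime p × p ∣ n × q ∣ p ∸ 1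
  step : ∀ n → (∀ {m} → m < n → P m) → P n
  step 1 _ _ q-prime q∣1 = ⊥-elim (prime∤1 q-prime q∣1)
  step n@(suc (suc _)) ih n-squarefree q-prime q∣totient-n
    with prime-factor {n} (s≤s z<s)
  ... | p , p-prime , divides m n≡mp = case (euclidsLemma (p ∸ 1) (totient m) q-prime q∣p∸1*totient-m)
    where
    p∤m : ¬ p ∣ m
    p∤m (divides t refl) = n-squarefree p p-prime (divides t (trans n≡mp (*-assoc t p p)))
    instance
      m≢0 : NonZero m
      m≢0 = m*n≢0⇒m≢0 m {{subst NonZero n≡mp _}}
    m∣n : m ∣ n
    m∣n = divides p (trans n≡mp (*-comm m p))
    m<n : m < n
    m<n = subst (m <_) (sym n≡mp) (m<m*n m p (prime⇒1<p p-prime))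
    q∣p∸1*totient-m : q ∣ (p ∸ 1) * totient m
    q∣p∸1*totient-m = subst (q ∣_) (trans (cong totient (trans n≡mp (*-comm m p))) (totient-prime* p-prime p∤m))
                            q∣totient-n
    case : q ∣ p ∸ 1 ⊎ q ∣ totient m → ∃ λ p → Prime p × p ∣ n × q ∣ p ∸ 1
    case (inj₁ q∣p∸1) = p , p-prime , divides m n≡mp , q∣p∸1
    case (inj₂ q∣totient-m)
      with ih m<n (λ r r-prime r²∣m → n-squarefree r r-prime (∣-trans r²∣m m∣n)) q-prime q∣totient-m
    ... | r , r-prime , r∣m , q∣r∸1 = r , r-prime , ∣-trans r∣m m∣n , q∣r∸1

-- Exponents annihilating all units

[1+x]^k-expand : ∀ x k → ∃ λ r → suc x ^ k ≡ 1 + k * x + x * x * r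
[1+x]^k-expand x zero = 0 , expand x
  where
  expand : ∀ x → 1 ≡ 1 + 0 * x + x * x * 0
  expand = solve-∀
[1+x]^k-expand x (suc k) with [1+x]^k-expand x k
... | r , eq = k + r + x * r , trans (cong (suc x *_) eq) (expand x k r)
  where
  expand : ∀ x k r → (1 + x) * (1 + k * x + x * x * r) ≡ 1 + (1 + k) * x + x * x * (k + r + x * r)
  expand = solve-∀

module _ {n e : ℕ} .{{_ : NonZero n}} (a^e≡1 : ∀ a → Coprime a n → (a ^ e) ≡ 1 [mod n ]) where

  -- with p² ∣ n and s = n / p, the unit 1 + s has (1 + s) ^ e ≡ 1 + e s (mod n), so n = s p ∣ e s
  square∣⇒∣exponent : Prime p → p * p ∣ n → p ∣ e
  square∣⇒∣exponent {p} p-prime (divides t n≡tpp) = *-cancelˡ-∣ s {{s≢0}} (subst (_∣ s * e) n≡sp n∣se)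
    where
    s = t * p
    n≡sp : n ≡ s * p
    n≡sp = trans n≡tpp (sym (*-assoc t p p))
    s≢0 : NonZero s
    s≢0 = m*n≢0⇒m≢0 s {{subst NonZero n≡sp (>-nonZero (>-nonZero⁻¹ n))}}
    1+s⊥n : Coprime (suc s) n
    1+s⊥n = suc-coprime (n∣m*n t) (∣-reflexive n≡sp)
    r = proj₁ ([1+x]^k-expand s e)
    n∣s*s*r : n ∣ s * s * r
    n∣s*s*r = ∣m⇒∣m*n r (divides t (trans (regroup t p) (cong (t *_) (sym n≡tpp))))
      where
      regroup : ∀ t p → t * p * (t * p) ≡ t * (t * (p * p))
      regroup = solve-∀
    1≡1+es : 1 ≡ (1 + e * s) [mod n ]
    1≡1+es = begin
      1 % n                           ≡⟨ a^e≡1 (suc s) 1+s⊥n ⟨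
      suc s ^ e % n                   ≡⟨ cong (_% n) (proj₂ ([1+x]^k-expand s e)) ⟩
      (1 + e * s + s * s * r) % n     ≡⟨ %-remove-+ʳ (1 + e * s) n∣s*s*r ⟩
      (1 + e * s) % n                 ∎
      where open ≡-Reasoning
    n∣se : n ∣ s * e
    n∣se = subst (n ∣_) (*-comm e s) (≡-+-mod⇒∣ 1 (e * s) 1≡1+es)

  -- for p ∥ n, every 0 < b < p lifts to a unit a ≡ b (mod p), so b ^ e ≡ 1 (mod p)
  prime∥⇒p∸1∣exponent : Prime p → p ∣ n → ¬ p * p ∣ n → (p ∸ 1) ∣ e
  prime∥⇒p∸1∣exponent {p} p-prime (divides m n≡mp) p²∤n = p∸1∣exponent p-prime b^e≡1
    where
    instance
      p≢0 : NonZero p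
      p≢0 = prime⇒nonZero p-prime
    p∤m : ¬ p ∣ m
    p∤m (divides t refl) = p²∤n (divides t (trans n≡mp (*-assoc t p p)))
    u = proj₁ (inverse-mod (coprime-sym (prime∤⇒coprime p-prime p∤m)))
    mu≡1 : (m * u) ≡ 1 [mod p ]
    mu≡1 = proj₂ (inverse-mod (coprime-sym (prime∤⇒coprime p-prime p∤m)))
    b^e≡1 : ∀ b → 0 < b → b < p → (b ^ e) ≡ 1 [mod p ]
    b^e≡1 b@(suc b′) _ b<p = begin
      b ^ e % p    ≡⟨ ^-cong-mod {n = p} {lift} {b} e lift≡b ⟨
      lift ^ e % p ≡⟨ ≡-mod-∣ (divides m n≡mp) (a^e≡1 lift lift⊥n) ⟩
      1 % p        ∎
      where
      open ≡-Reasoning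
      lift = 1 + m * u * b′
      lift≡b : lift ≡ b [mod p ]
      lift≡b = +-cong-mod {n = p} {1} {1} refl
        (trans (*-cong-mod {n = p} {m * u} {1} {b′} {b′} mu≡1 refl) (cong (_% p) (*-identityˡ b′)))
      lift⊥n : Coprime lift n
      lift⊥n {d} (d∣lift , d∣n) with prime⇒irreducible p-prime d∣p
        where
        d⊥m : Coprime d m
        d⊥m (c∣d , c∣m) = ∣1⇒≡1 (∣suc∧∣⇒∣1 (∣-trans c∣d d∣lift) (∣m⇒∣m*n b′ (∣m⇒∣m*n u c∣m)))
        d∣p : d ∣ p
        d∣p = coprime-divisor d⊥m (subst (d ∣_) n≡mp d∣n)
      ... | inj₁ d≡1 = d≡1
      ... | inj₂ refl = ⊥-elim (<-irrefl b≡0 z<s)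
        where
        b≡0 : 0 ≡ b
        b≡0 = begin
          0        ≡⟨ n∣m⇒m%n≡0 lift p d∣lift ⟨
          lift % d ≡⟨ lift≡b ⟩
          b % d    ≡⟨ m<n⇒m%n≡m b<p ⟩
          b        ∎

-- k ↦ a k permutes the units, so a ^ e * ∑_k k ^ e ≡ ∑_k (a k) ^ e ≡ ∑_k k ^ e
∑units-^-*-invariant : ∀ {n} .{{_ : NonZero n}} {a} e → Coprime a n →
  (a ^ e * ∑units n (_^ e)) ≡ ∑units n (_^ e) [mod n ]
∑units-^-*-invariant {n} {a} e a⊥n = begin
  (a ^ e * ∑units n (_^ e)) % n              ≡⟨ cong (_% n) (*-distribˡ-∑units n (a ^ e) (_^ e)) ⟩
  ∑units n (λ k → a ^ e * k ^ e) % n         ≡⟨ ∑units-cong-mod {g = λ k → a ^ e * k ^ e} (λ k _ → power k) ⟩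
  ∑units n (λ k → ((a * k) % n) ^ e) % n     ≡⟨ cong (_% n) (∑units-*-permute a⊥n (_^ e)) ⟩
  ∑units n (_^ e) % n                        ∎
  where
  open ≡-Reasoning
  power : ∀ k → (a ^ e * k ^ e) ≡ (((a * k) % n) ^ e) [mod n ]
  power k = trans (cong (_% n) (sym (^-distrib-* a k e))) (^-cong-mod e (sym (%-mod (a * k))))

φ≢0 : ∀ n .{{_ : NonZero n}} → NonZero (φ n)
φ≢0 n@(suc m) rewrite dec-true (coprime? 1 n) (1-coprimeTo n) = _

module _ {n : ℕ} .{{_ : NonZero n}} (a^n∸1≡1 : ∀ a → Coprime a n → (a ^ (n ∸ 1)) ≡ 1 [mod n ]) where

  carmichael⇒squarefree : Squarefree n
  carmichael⇒squarefree p p-prime p²∣n =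
    prime∤1 p-prime (∣n∧∣n∸1⇒∣1 (∣-trans (m∣m*n p) p²∣n) (square∣⇒∣exponent a^n∸1≡1 p-prime p²∣n))

  carmichael⇒rad[φ]∣n∸1 : rad (φ n) ∣ n ∸ 1
  carmichael⇒rad[φ]∣n∸1 = rad∣ (φ n) q∣φ⇒q∣n∸1
    where
    q∣φ⇒q∣n∸1 : ∀ q → Prime q → q ∣ φ n → q ∣ n ∸ 1
    q∣φ⇒q∣n∸1 q q-prime q∣φ = via-prime-factor
      (prime∣totient-squarefree n carmichael⇒squarefree q-prime (subst (q ∣_) (φ≡totient n) q∣φ))
      where
      via-prime-factor : (∃ λ p → Prime p × p ∣ n × q ∣ p ∸ 1) → q ∣ n ∸ 1
      via-prime-factor (p , p-prime , p∣n , q∣p∸1) =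
        ∣-trans q∣p∸1 (prime∥⇒p∸1∣exponent a^n∸1≡1 p-prime p∣n (carmichael⇒squarefree p p-prime))

  carmichael⇒powerSum≡φ : .{{_ : NonTrivial n}} → powerSum n ≡ φ n [mod n ]
  carmichael⇒powerSum≡φ = begin
    powerSum n % n                ≡⟨ cong (_% n) (powerSum≡∑units n) ⟩
    ∑units n (_^ (n ∸ 1)) % n     ≡⟨ ∑units-cong-mod a^n∸1≡1 ⟩
    totient n % n                 ≡⟨ cong (_% n) (φ≡totient n) ⟨
    φ n % n                       ∎
    where open ≡-Reasoning

-- φ(n) is a unit, and multiplying ∑_k k ^ (n − 1) ≡ φ(n) by a ^ (n − 1) permutes its terms
weak∧rad[φ]∣n∸1⇒carmichael : ∀ {n} .{{_ : NonZero n}} .{{_ : NonTrivial n}} →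
  powerSum n ≡ φ n [mod n ] → rad (φ n) ∣ n ∸ 1 → ∀ a → Coprime a n → (a ^ (n ∸ 1)) ≡ 1 [mod n ]
weak∧rad[φ]∣n∸1⇒carmichael {n} powerSum≡φ rad∣n∸1 a a⊥n = *-cancelˡ-mod φ⊥n (begin
  (φ n * a ^ e) % n               ≡⟨ *-cong-mod {a = φ n} {powerSum n} {a ^ e} {a ^ e} (sym powerSum≡φ) refl ⟩
  (powerSum n * a ^ e) % n        ≡⟨ cong (_% n) (*-comm (powerSum n) (a ^ e)) ⟩
  (a ^ e * powerSum n) % n        ≡⟨ cong (λ s → (a ^ e * s) % n) (powerSum≡∑units n) ⟩
  (a ^ e * ∑units n (_^ e)) % n   ≡⟨ ∑units-^-*-invariant e a⊥n ⟩
  ∑units n (_^ e) % n             ≡⟨ cong (_% n) (powerSum≡∑units n) ⟨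
  powerSum n % n                  ≡⟨ powerSum≡φ ⟩
  φ n % n                         ≡⟨ cong (_% n) (*-identityʳ (φ n)) ⟨
  (φ n * 1) % n                   ∎)
  where
  open ≡-Reasoning
  e = n ∸ 1
  φ⊥n : Coprime (φ n) n
  φ⊥n = primes-coprime⇒coprime λ q q-prime q∣φ q∣n →
    prime∤1 q-prime (∣n∧∣n∸1⇒∣1 q∣n (∣-trans (prime∣rad {{φ≢0 n}} q-prime q∣φ) rad∣n∸1))

corollary2p58 : (n : ℕ) → .{{_ : NonZero n}} → Composite n →
    Carmichael n ⇔ (WeakCarmichael n × rad (φ n) ∣ n ∸ 1)
corollary2p58 n n-composite = mk⇔
  (λ (_ , a^n∸1≡1) → (n-composite , carmichael⇒powerSum≡φ a^n∸1≡1) , carmichael⇒rad[φ]∣n∸1 a^n∸1≡1)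
  (λ ((_ , powerSum≡φ) , rad∣n∸1) → n-composite , weak∧rad[φ]∣n∸1⇒carmichael powerSum≡φ rad∣n∸1)
  where
  instance
    n>1 : NonTrivial n
    n>1 = composite⇒nonTrivial n-composite
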